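{- For integers $n\ge 1$ and $k\ge 0$, let $f_{\mathrm{FR}}(n,k)$ be the number of Fubini rankings with $n$ competitors having exactly $k$ lucky cars. Then $f_{\mathrm{FR}}(n,k)=k!\,S(n,k)$, where $S(n,k)$ is the Stirling number of the second kind.
   Context: A Fubini ranking with $n$ competitors is a tuple $\alpha=(a_1,\ldots,a_n)\in\{1,\ldots,n\}^n$ such that $a_i=1+|\{j: a_j<a_i\}|$ for every $i$ (a ranking with ties, where a $k$-fold tie at rank $i$ causes ranks $i+1,\ldots,i+k-1$ to be skipped). Lucky cars: cars $1,\ldots,n$ enter in order a one-way street with spots $1,\ldots,n$; car $i$ parks at spot $a_i$ if free, else at the first free spot after $a_i$; car $i$ is lucky if it parks at spot $a_i$. -}

module Defs where

open import Data.Nat using (ℕ; _!; zero; suc; _+_; _*_; _<ᵇ_; _≡ᵇ_; _≤ᵇ_)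
open import Data.Bool using (Bool; true; false; if_then_else_; _∧_; not)
open import Data.List using (List; []; _∷_; length; map; filter; concatMap; upTo)
open import Data.List.Relation.Unary.All using (All)
open import Relation.Nullary.Decidable using (Dec; yes; no)
open import Relation.Binary.PropositionalEquality using (_≡_)

S : ℕ → ℕ → ℕ
S zero    zero    = 1
S zero    (suc k) = 0
S (suc n) zero    = 0
S (suc n) (suc k) = suc k * S n (suc k) + S n k

tuples : ℕ → ℕ → List (List ℕ)
tuples n zero    = [] ∷ []
tuples n (suc m) = concatMap (λ a → map (a ∷_) (tuples n m)) (map suc (upTo n))

countLess : ℕ → List ℕ → ℕ
countLess x []       = 0
countLess x (a ∷ as) = (if a <ᵇ x then 1 else 0) + countLess x as

allᵇ : (ℕ → Bool) → List ℕ → Bool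
allᵇ p []       = true
allᵇ p (x ∷ xs) = p x ∧ allᵇ p xs

isFubiniᵇ : List ℕ → Bool
isFubiniᵇ α = allᵇ (λ a → a ≡ᵇ suc (countLess a α)) α

fubiniRankings : ℕ → List (List ℕ)
fubiniRankings n = filter (λ α → Data.Bool._≟_ (isFubiniᵇ α) true) (tuples n n)

memᵇ : ℕ → List ℕ → Bool
memᵇ x []       = false
memᵇ x (y ∷ ys) = (x ≡ᵇ y) Data.Bool.∨ memᵇ x ys

-- first free spot ≥ a (fuel bounds the search; spots beyond the street never arise
-- for tuples in {1..n}^n since at most n-1 spots are occupied when a car arrives)
firstFree : ℕ → ℕ → List ℕ → ℕ
firstFree zero       a occ = a
firstFree (suc fuel) a occ = if memᵇ a occ then firstFree fuel (suc a) occ else a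

-- parking process: given the list of occupied spots, park the remaining cars in
-- order and return the number of lucky cars (cars parking at their preferred spot)
luckyFrom : ℕ → List ℕ → List ℕ → ℕ
luckyFrom fuel occ []       = 0
luckyFrom fuel occ (a ∷ as) =
  (if memᵇ a occ then 0 else 1) + luckyFrom fuel (firstFree fuel a occ ∷ occ) as

lucky : List ℕ → ℕ
lucky α = luckyFrom (length α) [] α

fFR : ℕ → ℕ → ℕ
fFR n k = length (filter (λ α → lucky α Data.Nat.≟ k) (fubiniRankings n))

{-# OPTIONS --safe #-}
module Submission where

-- In a Fubini ranking the k competitors tied at rank v park, in order, in the spots
-- v, v+1, …, v+k−1, and these runs are disjoint because the next rank used is v+k.
-- Hence a car is lucky exactly when it is the first one with its preference, and the
-- number of lucky cars is the number d of distinct ranks.  Deleting the first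
-- competitor a of a ranking with n+1 competitors and closing the gap gives a ranking y
-- with n competitors.  Conversely y is re-extended either by tying a with one of the
-- d ranks of y (keeping d), or by opening a new rank at one of the d+1 places
-- a = 1 + |{j : y_j < a}| (raising d by one).  So f(n+1,k) = k·f(n,k) + k·f(n,k−1),
-- the recurrence of k!·S(n,k).

open import Defs
open import Data.Nat using (ℕ; suc; _*_; _!)
open import Relation.Binary.PropositionalEquality using (_≡_)

open import Data.Bool using (true; false; if_then_else_; _∧_; _∨_)
import Data.Bool
open import Data.List using (List; []; _∷_; length; map; filter; concat; concatMap; upTo; _++_)
open import Data.List.Properties using (≡-dec; map-upTo; map-∘; map-id-local; length-map)
open import Data.List.Membership.Propositional using (_∈_; _∉_; find)
open import Data.List.Membership.Propositional.Properties using (∈-map⁺; ∈-map⁻; ∈-concatMap⁻; ∈-upTo⁻)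
open import Data.List.Relation.Unary.All using (All; []; _∷_; all?; lookup; tabulate)
import Data.List.Relation.Unary.All as All
open import Data.List.Relation.Unary.All.Properties using (map⁺; map⁻)
open import Data.List.Relation.Unary.Any using (here; there)
open import Data.Nat using (zero; _+_; _∸_; _≤_; _<_; z≤n; s≤s; _≟_; _<?_; _≡ᵇ_; _<ᵇ_; pred)
open import Data.Nat.Properties
open import Data.Nat.Solver using (module +-*-Solver)
open import Data.List.Membership.DecPropositional _≟_ using (_∈?_; _∉?_)
open import Algebra.Properties.CommutativeSemigroup +-commutativeSemigroup using (interchange)
open import Data.Product using (_×_; _,_; proj₁; proj₂; ∃₂)
open import Function using (_∘_)
open import Function.Definitions using (Injective)
open import Function.Bundles using (_⇔_; mk⇔; Equivalence)
open import Function.Related.TypeIsomorphisms using (¬-cong-⇔)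
open import Relation.Binary.Definitions using (DecidableEquality; tri<; tri≈; tri>)
open import Relation.Binary.PropositionalEquality using (_≢_; refl; sym; trans; cong; cong₂; subst; module ≡-Reasoning)
open import Relation.Nullary using (Dec; yes; no; does; ¬_; contradiction)
open import Relation.Nullary.Decidable using (dec-true; dec-false; _×-dec_; _⊎-dec_)
open import Data.Sum using (_⊎_; inj₁; inj₂)
open +-*-Solver using (solve; _:*_; _:+_; _:=_)

private variable
  A : Set
  P Q : Set
  x c : A
  xs : List A
  f g : A → ℕ
  m n N : ℕ

-- Indicators and finite sums

𝟙 : Dec P → ℕ
𝟙 P? = if does P? then 1 else 0

𝟙-yes : (P? : Dec P) → P → 𝟙 P? ≡ 1
𝟙-yes P? p rewrite dec-true P? p = refl

𝟙-no : (P? : Dec P) → ¬ P → 𝟙 P? ≡ 0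
𝟙-no P? ¬p rewrite dec-false P? ¬p = refl

𝟙≤1 : (P? : Dec P) → 𝟙 P? ≤ 1
𝟙≤1 (yes _) = ≤-refl
𝟙≤1 (no _)  = z≤n

𝟙-⇔ : P ⇔ Q → (P? : Dec P) (Q? : Dec Q) → 𝟙 P? ≡ 𝟙 Q?
𝟙-⇔ P⇔Q (yes p) Q? = sym (𝟙-yes Q? (Equivalence.to P⇔Q p))
𝟙-⇔ P⇔Q (no ¬p) Q? = sym (𝟙-no Q? (¬p ∘ Equivalence.from P⇔Q))

𝟙-× : (P? : Dec P) (Q? : Dec Q) → 𝟙 (P? ×-dec Q?) ≡ 𝟙 P? * 𝟙 Q?
𝟙-× (yes _) Q? = sym (*-identityˡ (𝟙 Q?))
𝟙-× (no _)  Q? = refl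

𝟙-⊎ : ¬ (P × Q) → (P? : Dec P) (Q? : Dec Q) → 𝟙 (P? ⊎-dec Q?) ≡ 𝟙 P? + 𝟙 Q?
𝟙-⊎ disjoint (yes p) (yes q) = contradiction (p , q) disjoint
𝟙-⊎ disjoint (yes _) (no _)  = refl
𝟙-⊎ disjoint (no _)  Q?      = refl

𝟙-guard : (P? : Dec P) → (P → m ≡ n) → 𝟙 P? * m ≡ 𝟙 P? * n
𝟙-guard (yes p) m≡n = cong (1 *_) (m≡n p)
𝟙-guard (no _)  _   = refl

∑ : List A → (A → ℕ) → ℕ
∑ []       f = 0
∑ (x ∷ xs) f = f x + ∑ xs f

syntax ∑ xs (λ x → e) = ∑[ x ∈ xs ] e

∑-cong : (xs : List A) → (∀ {x} → x ∈ xs → f x ≡ g x) → ∑ xs f ≡ ∑ xs g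
∑-cong []       f≡g = refl
∑-cong (x ∷ xs) f≡g = cong₂ _+_ (f≡g (here refl)) (∑-cong xs (f≡g ∘ there))

∑-mono-≤ : (xs : List A) → (∀ {x} → x ∈ xs → f x ≤ g x) → ∑ xs f ≤ ∑ xs g
∑-mono-≤ []       f≤g = z≤n
∑-mono-≤ (x ∷ xs) f≤g = +-mono-≤ (f≤g (here refl)) (∑-mono-≤ xs (f≤g ∘ there))

∑-zero : (xs : List A) → ∑[ x ∈ xs ] 0 ≡ 0
∑-zero []       = refl
∑-zero (x ∷ xs) = ∑-zero xs

∑-one : (xs : List A) → ∑[ x ∈ xs ] 1 ≡ length xs
∑-one []       = refl
∑-one (x ∷ xs) = cong suc (∑-one xs)

∑-distrib-+ : (xs : List A) → ∑[ x ∈ xs ] (f x + g x) ≡ ∑ xs f + ∑ xs g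
∑-distrib-+ []                 = refl
∑-distrib-+ {f = f} {g} (x ∷ xs) = trans (cong (f x + g x +_) (∑-distrib-+ xs)) (interchange (f x) (g x) _ _)

∑-*ˡ : (c : ℕ) (xs : List A) → ∑[ x ∈ xs ] (c * f x) ≡ c * ∑ xs f
∑-*ˡ c []                 = sym (*-zeroʳ c)
∑-*ˡ {f = f} c (x ∷ xs) = trans (cong (c * f x +_) (∑-*ˡ c xs)) (sym (*-distribˡ-+ c (f x) _))

∑-*ʳ : (c : ℕ) (xs : List A) → ∑[ x ∈ xs ] (f x * c) ≡ ∑ xs f * c
∑-*ʳ {f = f} c xs = begin
  ∑[ x ∈ xs ] (f x * c) ≡⟨ ∑-cong xs (λ {x} _ → *-comm (f x) c) ⟩
  ∑[ x ∈ xs ] (c * f x) ≡⟨ ∑-*ˡ c xs ⟩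
  c * ∑ xs f            ≡⟨ *-comm c _ ⟩
  ∑ xs f * c            ∎
  where open ≡-Reasoning

∑-++ : (xs ys : List A) → ∑ (xs ++ ys) f ≡ ∑ xs f + ∑ ys f
∑-++ []               ys = refl
∑-++ {f = f} (x ∷ xs) ys = trans (cong (f x +_) (∑-++ xs ys)) (sym (+-assoc (f x) _ _))

∑-map : {B : Set} {f : B → ℕ} (h : A → B) (xs : List A) → ∑ (map h xs) f ≡ ∑[ x ∈ xs ] f (h x)
∑-map h []               = refl
∑-map {f = f} h (x ∷ xs) = cong (f (h x) +_) (∑-map h xs)

∑-concatMap : {B : Set} {f : B → ℕ} (h : A → List B) (xs : List A) → ∑ (concatMap h xs) f ≡ ∑[ x ∈ xs ] ∑ (h x) f
∑-concatMap h []       = refl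
∑-concatMap h (x ∷ xs) = trans (∑-++ (h x) (concat (map h xs))) (cong (∑ (h x) _ +_) (∑-concatMap h xs))

∑-comm : {B : Set} (xs : List A) (ys : List B) (F : A → B → ℕ) → ∑[ x ∈ xs ] ∑[ y ∈ ys ] F x y ≡ ∑[ y ∈ ys ] ∑[ x ∈ xs ] F x y
∑-comm []       ys F = sym (∑-zero ys)
∑-comm (x ∷ xs) ys F = trans (cong (∑ ys (F x) +_) (∑-comm xs ys F)) (sym (∑-distrib-+ ys))

length-filter : {P : A → Set} (P? : ∀ x → Dec (P x)) (xs : List A) → length (filter P? xs) ≡ ∑[ x ∈ xs ] 𝟙 (P? x)
length-filter P? []       = refl
length-filter P? (x ∷ xs) with does (P? x)
... | true  = cong suc (length-filter P? xs)
... | false = length-filter P? xs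

∑-filter : {P : A → Set} (P? : ∀ x → Dec (P x)) (xs : List A) → ∑ (filter P? xs) f ≡ ∑[ x ∈ xs ] (𝟙 (P? x) * f x)
∑-filter P? []               = refl
∑-filter {f = f} P? (x ∷ xs) with does (P? x)
... | true  = cong₂ _+_ (sym (+-identityʳ (f x))) (∑-filter P? xs)
... | false = ∑-filter P? xs

∑-δ : (_≟ᴬ_ : DecidableEquality A) (xs : List A) → ∑[ x ∈ xs ] 𝟙 (c ≟ᴬ x) ≡ 1 → ∑[ x ∈ xs ] (𝟙 (c ≟ᴬ x) * f x) ≡ f c
∑-δ {c = c} {f = f} _≟ᴬ_ xs once = begin
  ∑[ x ∈ xs ] (𝟙 (c ≟ᴬ x) * f x) ≡⟨ ∑-cong xs (λ {x} _ → 𝟙-guard (c ≟ᴬ x) (λ c≡x → cong f (sym c≡x))) ⟩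
  ∑[ x ∈ xs ] (𝟙 (c ≟ᴬ x) * f c) ≡⟨ ∑-*ʳ (f c) xs ⟩
  ∑[ x ∈ xs ] 𝟙 (c ≟ᴬ x) * f c   ≡⟨ cong (_* f c) once ⟩
  1 * f c                        ≡⟨ *-identityˡ (f c) ⟩
  f c                            ∎
  where open ≡-Reasoning

-- Tuples

infix 4 _≟ₗ_
_≟ₗ_ : DecidableEquality (List ℕ)
_≟ₗ_ = ≡-dec _≟_

ranks : ℕ → List ℕ
ranks N = map suc (upTo N)

InRange : ℕ → ℕ → Set
InRange N v = 0 < v × v ≤ N

IsTuple : ℕ → ℕ → List ℕ → Set
IsTuple N m β = length β ≡ m × All (InRange N) β

∈-ranks⁻ : x ∈ ranks N → InRange N x
∈-ranks⁻ x∈ with _ , i∈ , refl ← ∈-map⁻ suc x∈ = s≤s z≤n , ∈-upTo⁻ i∈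

∈-tuples⁻ : {β : List ℕ} → β ∈ tuples N m → IsTuple N m β
∈-tuples⁻ {m = zero}      (here refl) = refl , []
∈-tuples⁻ {N} {m = suc m} β∈
  with a , a∈ , β∈′ ← find (∈-concatMap⁻ (λ a → map (a ∷_) (tuples N m)) {xs = ranks N} β∈)
  with β′ , β′∈ , refl ← ∈-map⁻ (a ∷_) β∈′
  with len , β′-in-range ← ∈-tuples⁻ β′∈
  = cong suc len , ∈-ranks⁻ a∈ ∷ β′-in-range

∑-upTo-suc : (f : ℕ → ℕ) (N : ℕ) → ∑ (upTo (suc N)) f ≡ f 0 + ∑[ x ∈ upTo N ] f (suc x)
∑-upTo-suc f N = cong (f 0 +_) (trans (cong (λ xs → ∑ xs f) (sym (map-upTo suc N))) (∑-map suc (upTo N)))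

∑-upTo-δ : c < N → ∑[ x ∈ upTo N ] 𝟙 (c ≟ x) ≡ 1
∑-upTo-δ {zero}  {suc N} _          = trans (∑-upTo-suc (λ x → 𝟙 (0 ≟ x)) N) (cong suc (∑-zero (upTo N)))
∑-upTo-δ {suc c} {suc N} (s≤s c<N) = trans (∑-upTo-suc (λ x → 𝟙 (suc c ≟ x)) N) (∑-upTo-δ c<N)

∑-ranks-δ : InRange N c → ∑[ a ∈ ranks N ] 𝟙 (c ≟ a) ≡ 1
∑-ranks-δ {N} {suc c} (_ , c<N) = trans (∑-map suc (upTo N)) (∑-upTo-δ c<N)

∑-tuples-suc : (N m : ℕ) (F : List ℕ → ℕ) → ∑ (tuples N (suc m)) F ≡ ∑[ a ∈ ranks N ] ∑[ β ∈ tuples N m ] F (a ∷ β)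
∑-tuples-suc N m F =
  trans (∑-concatMap _ (ranks N)) (∑-cong (ranks N) (λ {a} _ → ∑-map (a ∷_) (tuples N m)))

∑-tuples-δ : {γ : List ℕ} → IsTuple N m γ → ∑[ β ∈ tuples N m ] 𝟙 (γ ≟ₗ β) ≡ 1
∑-tuples-δ {m = zero}  {[]} _ = refl
∑-tuples-δ {N} {suc m} {c ∷ γ} (len , c-in-range ∷ γ-in-range) = begin
  ∑[ β ∈ tuples N (suc m) ] 𝟙 (c ∷ γ ≟ₗ β)
    ≡⟨ ∑-tuples-suc N m _ ⟩
  ∑[ a ∈ ranks N ] ∑[ β ∈ tuples N m ] 𝟙 ((c ≟ a) ×-dec (γ ≟ₗ β))
    ≡⟨ ∑-cong (ranks N) (λ {a} _ → trans (∑-cong (tuples N m) (λ {β} _ → 𝟙-× (c ≟ a) (γ ≟ₗ β))) (∑-*ˡ (𝟙 (c ≟ a)) (tuples N m))) ⟩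
  ∑[ a ∈ ranks N ] (𝟙 (c ≟ a) * ∑[ β ∈ tuples N m ] 𝟙 (γ ≟ₗ β))
    ≡⟨ ∑-cong (ranks N) (λ {a} _ → trans (cong (𝟙 (c ≟ a) *_) (∑-tuples-δ (suc-injective len , γ-in-range))) (*-identityʳ _)) ⟩
  ∑[ a ∈ ranks N ] 𝟙 (c ≟ a)
    ≡⟨ ∑-ranks-δ c-in-range ⟩
  1 ∎
  where open ≡-Reasoning

-- Fubini rankings and their runs

IsFubini : List ℕ → Set
IsFubini α = All (λ v → v ≡ suc (countLess v α)) α

isFubini? : (α : List ℕ) → Dec (IsFubini α)
isFubini? α = all? (λ v → v ≟ suc (countLess v α)) α

allᵇ-does : {P : ℕ → Set} (P? : ∀ x → Dec (P x)) (xs : List ℕ) → allᵇ (does ∘ P?) xs ≡ does (all? P? xs)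
allᵇ-does P? []       = refl
allᵇ-does P? (x ∷ xs) = cong (does (P? x) ∧_) (allᵇ-does P? xs)

isFubiniᵇ-does : (α : List ℕ) → isFubiniᵇ α ≡ does (isFubini? α)
isFubiniᵇ-does α = allᵇ-does (λ v → v ≟ suc (countLess v α)) α

multiplicity : ℕ → List ℕ → ℕ
multiplicity v xs = ∑[ x ∈ xs ] 𝟙 (v ≟ x)

∈⇒0<multiplicity : {v : ℕ} {xs : List ℕ} → v ∈ xs → 0 < multiplicity v xs
∈⇒0<multiplicity {v} (here refl) = ≤-trans (≤-reflexive (sym (𝟙-yes (v ≟ v) refl))) (m≤m+n _ _)
∈⇒0<multiplicity     (there v∈)  = ≤-trans (∈⇒0<multiplicity v∈) (m≤n+m _ _)

0<multiplicity⇒∈ : {v : ℕ} (xs : List ℕ) → 0 < multiplicity v xs → v ∈ xs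
0<multiplicity⇒∈ {v} (x ∷ xs) 0<m with v ≟ x
... | yes refl = here refl
... | no  v≢x  = there (0<multiplicity⇒∈ xs (subst (0 <_) (cong (_+ multiplicity v xs) (𝟙-no (v ≟ x) v≢x)) 0<m))

<multiplicity⇒∈ : {v j : ℕ} (xs : List ℕ) → j < multiplicity v xs → v ∈ xs
<multiplicity⇒∈ xs j< = 0<multiplicity⇒∈ xs (≤-trans (s≤s z≤n) j<)

countLess-∑ : (v : ℕ) (xs : List ℕ) → countLess v xs ≡ ∑[ x ∈ xs ] 𝟙 (x <? v)
countLess-∑ v []       = refl
countLess-∑ v (x ∷ xs) = cong (𝟙 (x <? v) +_) (countLess-∑ v xs)

countLess+multiplicity≤countLess : {u v : ℕ} (xs : List ℕ) → u < v → countLess u xs + multiplicity u xs ≤ countLess v xs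
countLess+multiplicity≤countLess {u} {v} xs u<v rewrite countLess-∑ u xs | countLess-∑ v xs =
  ≤-trans (≤-reflexive (sym (∑-distrib-+ xs))) (∑-mono-≤ xs (λ {x} _ → pointwise (x <? u) (u ≟ x) (x <? v)))
  where
  pointwise : ∀ {x} (x<u? : Dec (x < u)) (u≡x? : Dec (u ≡ x)) (x<v? : Dec (x < v)) → 𝟙 x<u? + 𝟙 u≡x? ≤ 𝟙 x<v?
  pointwise (yes x<u) (yes refl) _         = contradiction x<u (<-irrefl refl)
  pointwise (yes x<u) (no _)     x<v?      = ≤-reflexive (sym (𝟙-yes x<v? (<-trans x<u u<v)))
  pointwise (no _)    (yes refl) x<v?      = ≤-reflexive (sym (𝟙-yes x<v? u<v))
  pointwise (no _)    (no _)     _         = z≤n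

countLess+multiplicity≤length : (v : ℕ) (xs : List ℕ) → countLess v xs + multiplicity v xs ≤ length xs
countLess+multiplicity≤length v xs rewrite countLess-∑ v xs =
  ≤-trans (≤-reflexive (sym (∑-distrib-+ xs))) (≤-trans (∑-mono-≤ xs (λ {x} _ → pointwise (x <? v) (v ≟ x))) (≤-reflexive (∑-one xs)))
  where
  pointwise : ∀ {x} (x<v? : Dec (x < v)) (v≡x? : Dec (v ≡ x)) → 𝟙 x<v? + 𝟙 v≡x? ≤ 1
  pointwise (yes x<v) (yes refl) = contradiction x<v (<-irrefl refl)
  pointwise (yes _)   (no _)     = ≤-refl
  pointwise (no _)    v≡x?       = 𝟙≤1 v≡x?

IsFubini⇒InRange : {α : List ℕ} → IsFubini α → All (InRange (length α)) α
IsFubini⇒InRange {α} F = tabulate λ {v} v∈ → subst (InRange (length α)) (sym (lookup F v∈))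
  (s≤s z≤n , <-≤-trans (m<m+n _ (∈⇒0<multiplicity v∈)) (countLess+multiplicity≤length v α))

run≤next : {α : List ℕ} {u v : ℕ} → IsFubini α → u ∈ α → v ∈ α → u < v → u + multiplicity u α ≤ v
run≤next {α} {u} {v} F u∈ v∈ u<v = begin
  u + multiplicity u α                   ≡⟨ cong (_+ multiplicity u α) (lookup F u∈) ⟩
  suc (countLess u α + multiplicity u α) ≤⟨ s≤s (countLess+multiplicity≤countLess α u<v) ⟩
  suc (countLess v α)                    ≡⟨ sym (lookup F v∈) ⟩
  v                                      ∎
  where open ≤-Reasoning

runs-ordered : {α : List ℕ} {u v j k : ℕ} → IsFubini α →
                  j < multiplicity u α → k < multiplicity v α → u < v → u + j < v + k
runs-ordered {α} {u} {v} {j} {k} F j< k< u<v = begin-strict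
  u + j                <⟨ +-monoʳ-< u j< ⟩
  u + multiplicity u α ≤⟨ run≤next F (<multiplicity⇒∈ α j<) (<multiplicity⇒∈ α k<) u<v ⟩
  v                    ≤⟨ m≤m+n v k ⟩
  v + k                ∎
  where open ≤-Reasoning

runs-disjoint : {α : List ℕ} {u v j k : ℕ} → IsFubini α →
                j < multiplicity u α → k < multiplicity v α → u + j ≡ v + k → u ≡ v
runs-disjoint {u = u} {v} F j< k< u+j≡v+k with <-cmp u v
... | tri≈ _ u≡v _ = u≡v
... | tri< u<v _ _ = contradiction u+j≡v+k (<⇒≢ (runs-ordered F j< k< u<v))
... | tri> _ _ v<u = contradiction (sym u+j≡v+k) (<⇒≢ (runs-ordered F k< j< v<u))

tie-skips-next : {α : List ℕ} {a : ℕ} → IsFubini α → 1 < multiplicity a α → suc a ∉ α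
tie-skips-next {α} {a} F 1<m sa∈ = <⇒≱ 1<m (+-cancelˡ-≤ a _ 1
  (subst (a + multiplicity a α ≤_) (+-comm 1 a) (run≤next F (<multiplicity⇒∈ α 1<m) sa∈ (n<1+n a))))

multiplicity-≡ : {a : ℕ} (xs : List ℕ) → multiplicity a (a ∷ xs) ≡ suc (multiplicity a xs)
multiplicity-≡ {a} xs = cong (_+ multiplicity a xs) (𝟙-yes (a ≟ a) refl)

multiplicity-≢ : {v a : ℕ} (xs : List ℕ) → v ≢ a → multiplicity v (a ∷ xs) ≡ multiplicity v xs
multiplicity-≢ {v} {a} xs v≢a = cong (_+ multiplicity v xs) (𝟙-no (v ≟ a) v≢a)

-- Parking

memᵇ-does : (x : ℕ) (ys : List ℕ) → memᵇ x ys ≡ does (x ∈? ys)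
memᵇ-does x []       = refl
memᵇ-does x (y ∷ ys) = cong ((x ≡ᵇ y) ∨_) (memᵇ-does x ys)

if-memᵇ : (x : ℕ) (ys : List ℕ) → (if memᵇ x ys then 0 else 1) ≡ 𝟙 (x ∉? ys)
if-memᵇ x ys rewrite memᵇ-does x ys with x ∈? ys
... | yes _ = refl
... | no  _ = refl

firstFree-run : (fuel a c : ℕ) {occ : List ℕ} → c ≤ fuel →
                (∀ {t} → t < c → a + t ∈ occ) → a + c ∉ occ → firstFree fuel a occ ≡ a + c
firstFree-run zero a zero _ _ _ = sym (+-identityʳ a)
firstFree-run (suc fuel) a zero {occ} _ _ free
  rewrite memᵇ-does a occ | dec-false (a ∈? occ) (free ∘ subst (_∈ occ) (sym (+-identityʳ a)))
  = sym (+-identityʳ a)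
firstFree-run (suc fuel) a (suc c) {occ} (s≤s c≤fuel) taken free
  rewrite memᵇ-does a occ | dec-true (a ∈? occ) (subst (_∈ occ) (+-identityʳ a) (taken (s≤s z≤n)))
  = trans (firstFree-run fuel (suc a) c c≤fuel (λ t<c → subst (_∈ occ) (+-suc a _) (taken (s≤s t<c)))
                                             (free ∘ subst (_∈ occ) (sym (+-suc a c))))
          (sym (+-suc a c))

#new : List ℕ → List ℕ → ℕ
#new seen []      = 0
#new seen (a ∷ r) = 𝟙 (a ∉? seen) + #new (a ∷ seen) r

#distinct : List ℕ → ℕ
#distinct = #new []

Covered : List ℕ → ℕ → Set
Covered seen s = ∃₂ λ v j → j < multiplicity v seen × v + j ≡ s

Covered-∷ : {a s : ℕ} (seen : List ℕ) → Covered (a ∷ seen) s ⇔ (s ≡ a + multiplicity a seen ⊎ Covered seen s)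
Covered-∷ {a} {s} seen = mk⇔ to from
  where
  to : Covered (a ∷ seen) s → s ≡ a + multiplicity a seen ⊎ Covered seen s
  to (v , j , j< , refl) with v ≟ a
  ... | no  v≢a = inj₂ (v , j , subst (j <_) (multiplicity-≢ seen v≢a) j< , refl)
  ... | yes refl with m≤n⇒m<n∨m≡n (≤-pred (subst (j <_) (multiplicity-≡ {v} seen) j<))
  ...   | inj₁ j<m  = inj₂ (v , j , j<m , refl)
  ...   | inj₂ refl = inj₁ refl
  from : s ≡ a + multiplicity a seen ⊎ Covered seen s → Covered (a ∷ seen) s
  from (inj₁ refl)                = a , multiplicity a seen , subst (multiplicity a seen <_) (sym (multiplicity-≡ {a} seen)) ≤-refl , refl
  from (inj₂ (v , j , j< , v+j≡s)) = v , j , ≤-trans j< (m≤n+m _ (𝟙 (v ≟ a))) , v+j≡s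

module Parking {α : List ℕ} (F : IsFubini α) where

  Prefix : List ℕ → List ℕ → Set
  Prefix seen r = ∀ v → multiplicity v seen + multiplicity v r ≡ multiplicity v α

  Occupied : List ℕ → List ℕ → Set
  Occupied occ seen = ∀ s → s ∈ occ ⇔ Covered seen s

  module Step (a : ℕ) (seen r : List ℕ) (prefix : Prefix seen (a ∷ r)) where

    seen≤α : ∀ v → multiplicity v seen ≤ multiplicity v α
    seen≤α v = subst (multiplicity v seen ≤_) (prefix v) (m≤m+n _ _)

    a-pending : multiplicity a seen < multiplicity a α
    a-pending = subst (multiplicity a seen <_) (prefix a)
      (subst (λ m → multiplicity a seen < multiplicity a seen + m) (sym (multiplicity-≡ {a} r)) (m<m+n _ (s≤s z≤n)))

    covered-own-run : ∀ {t} → t ≤ multiplicity a seen → Covered seen (a + t) → t < multiplicity a seen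
    covered-own-run {t} t≤ (v , j , j< , v+j≡a+t)
      with refl ← runs-disjoint F (≤-trans j< (seen≤α v)) (≤-<-trans t≤ a-pending) v+j≡a+t
      rewrite +-cancelˡ-≡ v j t v+j≡a+t = j<

    Prefix-step : Prefix (a ∷ seen) r
    Prefix-step v = trans (cong (_+ multiplicity v r) (+-comm (𝟙 (v ≟ a)) (multiplicity v seen)))
                          (trans (+-assoc (multiplicity v seen) _ _) (prefix v))

    module _ {occ : List ℕ} (occupied : Occupied occ seen) where

      occupied⇔seen : a ∈ occ ⇔ a ∈ seen
      occupied⇔seen = mk⇔
        (λ a∈occ → <multiplicity⇒∈ seen (covered-own-run z≤n (Equivalence.to (occupied (a + 0)) (subst (_∈ occ) (sym (+-identityʳ a)) a∈occ))))
        (λ a∈seen → subst (_∈ occ) (+-identityʳ a) (Equivalence.from (occupied (a + 0)) (a , 0 , ∈⇒0<multiplicity a∈seen , refl)))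

      parks-after-run : firstFree (length α) a occ ≡ a + multiplicity a seen
      parks-after-run = firstFree-run (length α) a (multiplicity a seen)
        (≤-trans (<⇒≤ a-pending) (≤-trans (m≤n+m _ _) (countLess+multiplicity≤length a α)))
        (λ t<c → Equivalence.from (occupied _) (a , _ , t<c , refl))
        (λ c∈occ → <-irrefl refl (covered-own-run ≤-refl (Equivalence.to (occupied _) c∈occ)))

      Occupied-step : Occupied ((a + multiplicity a seen) ∷ occ) (a ∷ seen)
      Occupied-step s = mk⇔
        (λ { (here refl) → Equivalence.from (Covered-∷ seen) (inj₁ refl)
           ; (there s∈)  → Equivalence.from (Covered-∷ seen) (inj₂ (Equivalence.to (occupied s) s∈)) })
        (λ covered → case (Equivalence.to (Covered-∷ seen) covered))
        where
        case : s ≡ a + multiplicity a seen ⊎ Covered seen s → s ∈ (a + multiplicity a seen) ∷ occ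
        case (inj₁ refl)    = here refl
        case (inj₂ covered) = there (Equivalence.from (occupied s) covered)

  luckyFrom≡#new : (r seen occ : List ℕ) → Prefix seen r → Occupied occ seen → luckyFrom (length α) occ r ≡ #new seen r
  luckyFrom≡#new []      seen occ _      _        = refl
  luckyFrom≡#new (a ∷ r) seen occ prefix occupied =
    cong₂ _+_ (trans (if-memᵇ a occ) (𝟙-⇔ (¬-cong-⇔ (occupied⇔seen occupied)) (a ∉? occ) (a ∉? seen)))
              (luckyFrom≡#new r (a ∷ seen) _ Prefix-step occupied′)
    where
    open Step a seen r prefix
    occupied′ : Occupied (firstFree (length α) a occ ∷ occ) (a ∷ seen)
    occupied′ = subst (λ spot → Occupied (spot ∷ occ) (a ∷ seen)) (sym (parks-after-run occupied))
                      (Occupied-step occupied)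

lucky≡#distinct : {α : List ℕ} → IsFubini α → lucky α ≡ #distinct α
lucky≡#distinct {α} F = Parking.luckyFrom≡#new F α [] [] (λ _ → refl) (λ s → mk⇔ (λ ()) λ { (_ , _ , () , _) })

-- Distinct ranks

∈-∷-cong : {x z : ℕ} {s₁ s₂ : List ℕ} → z ∈ s₁ ⇔ z ∈ s₂ → z ∈ x ∷ s₁ ⇔ z ∈ x ∷ s₂
∈-∷-cong same = mk⇔ (λ { (here z≡x) → here z≡x ; (there z∈) → there (Equivalence.to same z∈) })
                    (λ { (here z≡x) → here z≡x ; (there z∈) → there (Equivalence.from same z∈) })

#new-cong : {s₁ s₂ : List ℕ} (r : List ℕ) → (∀ {z} → z ∈ r → z ∈ s₁ ⇔ z ∈ s₂) → #new s₁ r ≡ #new s₂ r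
#new-cong []                _    = refl
#new-cong {s₁} {s₂} (x ∷ r) same =
  cong₂ _+_ (𝟙-⇔ (¬-cong-⇔ (same (here refl))) (x ∉? s₁) (x ∉? s₂))
            (#new-cong r (λ z∈r → ∈-∷-cong (same (there z∈r))))

#new-∷-∉ : {a : ℕ} (seen r : List ℕ) → a ∉ r → #new (a ∷ seen) r ≡ #new seen r
#new-∷-∉ seen r a∉r = #new-cong r λ z∈r →
  mk⇔ (λ { (here refl) → contradiction z∈r a∉r ; (there z∈) → z∈ }) there

#new-∷-∈ : {a : ℕ} (seen r : List ℕ) → a ∈ r → a ∉ seen → suc (#new (a ∷ seen) r) ≡ #new seen r
#new-∷-∈ {a} seen (x ∷ r) a∈ a∉seen with x ≟ a
... | yes refl = trans
  (cong₂ (λ i n → suc (i + n)) (𝟙-no (x ∉? x ∷ seen) (λ x∉ → x∉ (here refl)))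
                               (#new-cong r (λ _ → mk⇔ (λ { (here z≡x) → here z≡x ; (there z∈) → z∈ }) there)))
  (cong (_+ #new (x ∷ seen) r) (sym (𝟙-yes (x ∉? seen) a∉seen)))
... | no x≢a with a∈
...   | here a≡x = contradiction (sym a≡x) x≢a
...   | there a∈r = begin
  suc (𝟙 (x ∉? a ∷ seen) + #new (x ∷ a ∷ seen) r)  ≡⟨ sym (+-suc _ _) ⟩
  𝟙 (x ∉? a ∷ seen) + suc (#new (x ∷ a ∷ seen) r)  ≡⟨ cong₂ (λ i n → i + suc n) (𝟙-⇔ (¬-cong-⇔ x∈⇔) (x ∉? a ∷ seen) (x ∉? seen)) (#new-cong r λ _ → swap) ⟩
  𝟙 (x ∉? seen) + suc (#new (a ∷ x ∷ seen) r)      ≡⟨ cong (𝟙 (x ∉? seen) +_) (#new-∷-∈ (x ∷ seen) r a∈r a∉x∷seen) ⟩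
  𝟙 (x ∉? seen) + #new (x ∷ seen) r                ∎
  where
  open ≡-Reasoning
  x∈⇔ : x ∈ a ∷ seen ⇔ x ∈ seen
  x∈⇔ = mk⇔ (λ { (here x≡a) → contradiction x≡a x≢a ; (there x∈) → x∈ }) there
  a∉x∷seen : a ∉ x ∷ seen
  a∉x∷seen (here a≡x) = x≢a (sym a≡x)
  a∉x∷seen (there a∈) = a∉seen a∈
  swap : ∀ {z} → z ∈ x ∷ a ∷ seen ⇔ z ∈ a ∷ x ∷ seen
  swap = mk⇔ exchange exchange
    where
    exchange : ∀ {z u w} {s : List ℕ} → z ∈ u ∷ w ∷ s → z ∈ w ∷ u ∷ s
    exchange (here z≡u)         = there (here z≡u)
    exchange (there (here z≡w)) = here z≡w
    exchange (there (there z∈)) = there (there z∈)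

#new-map : {h : ℕ → ℕ} → Injective _≡_ _≡_ h → (seen r : List ℕ) → #new (map h seen) (map h r) ≡ #new seen r
#new-map         h-inj seen []      = refl
#new-map {h = h} h-inj seen (x ∷ r) = cong₂ _+_ (𝟙-⇔ (¬-cong-⇔ image) (h x ∉? map h seen) (x ∉? seen)) (#new-map h-inj (x ∷ seen) r)
  where
  image : h x ∈ map h seen ⇔ x ∈ seen
  image = mk⇔ (λ hx∈ → let _ , z∈ , hx≡hz = ∈-map⁻ h hx∈ in subst (_∈ seen) (sym (h-inj hx≡hz)) z∈) (∈-map⁺ h)

#new-∑ : (seen r : List ℕ) → All (InRange N) r → #new seen r ≡ ∑[ a ∈ ranks N ] 𝟙 ((a ∈? r) ×-dec (a ∉? seen))
#new-∑ {N} seen []      _                  = sym (∑-zero (ranks N))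
#new-∑ {N} seen (x ∷ r) (x-in-range ∷ r-in-range) = begin
  𝟙 (x ∉? seen) + #new (x ∷ seen) r
    ≡⟨ cong₂ _+_ (sym (∑-δ {c = x} {f = λ a → 𝟙 (a ∉? seen)} _≟_ (ranks N) (∑-ranks-δ x-in-range))) (#new-∑ (x ∷ seen) r r-in-range) ⟩
  ∑[ a ∈ ranks N ] (𝟙 (x ≟ a) * 𝟙 (a ∉? seen)) + ∑[ a ∈ ranks N ] 𝟙 ((a ∈? r) ×-dec (a ∉? x ∷ seen))
    ≡⟨ sym (∑-distrib-+ (ranks N)) ⟩
  ∑[ a ∈ ranks N ] (𝟙 (x ≟ a) * 𝟙 (a ∉? seen) + 𝟙 ((a ∈? r) ×-dec (a ∉? x ∷ seen)))
    ≡⟨ ∑-cong (ranks N) (λ {a} _ → split a) ⟩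
  ∑[ a ∈ ranks N ] 𝟙 ((a ∈? x ∷ r) ×-dec (a ∉? seen)) ∎
  where
  open ≡-Reasoning
  split : ∀ a → 𝟙 (x ≟ a) * 𝟙 (a ∉? seen) + 𝟙 ((a ∈? r) ×-dec (a ∉? x ∷ seen)) ≡ 𝟙 ((a ∈? x ∷ r) ×-dec (a ∉? seen))
  split a = begin
    𝟙 (x ≟ a) * 𝟙 (a ∉? seen) + 𝟙 later? ≡⟨ cong (_+ 𝟙 later?) (sym (𝟙-× (x ≟ a) (a ∉? seen))) ⟩
    𝟙 first? + 𝟙 later?                   ≡⟨ sym (𝟙-⊎ (λ ((x≡a , _) , (_ , a∉x∷seen)) → a∉x∷seen (here (sym x≡a))) first? later?) ⟩
    𝟙 (first? ⊎-dec later?)               ≡⟨ 𝟙-⇔ first-or-later (first? ⊎-dec later?) ((a ∈? x ∷ r) ×-dec (a ∉? seen)) ⟩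
    𝟙 ((a ∈? x ∷ r) ×-dec (a ∉? seen))    ∎
    where
    first? : Dec (x ≡ a × a ∉ seen)
    first? = (x ≟ a) ×-dec (a ∉? seen)
    later? : Dec (a ∈ r × a ∉ x ∷ seen)
    later? = (a ∈? r) ×-dec (a ∉? x ∷ seen)
    first-or-later : ((x ≡ a × a ∉ seen) ⊎ (a ∈ r × a ∉ x ∷ seen)) ⇔ (a ∈ x ∷ r × a ∉ seen)
    first-or-later = mk⇔
      (λ { (inj₁ (refl , a∉)) → here refl , a∉ ; (inj₂ (a∈r , a∉)) → there a∈r , a∉ ∘ there })
      λ { (here refl , a∉) → inj₁ (refl , a∉)
        ; (there a∈r , a∉) → case (a ≟ x) a∈r a∉ }
      where
      case : Dec (a ≡ x) → a ∈ r → a ∉ seen → (x ≡ a × a ∉ seen) ⊎ (a ∈ r × a ∉ x ∷ seen)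
      case (yes a≡x) _   a∉ = inj₁ (sym a≡x , a∉)
      case (no a≢x)  a∈r a∉ = inj₂ (a∈r , λ { (here a≡x) → a≢x a≡x ; (there a∈) → a∉ a∈ })

#distinct-∑ : (y : List ℕ) → All (InRange N) y → #distinct y ≡ ∑[ a ∈ ranks N ] 𝟙 (a ∈? y)
#distinct-∑ {N} y y-in-range = trans (#new-∑ [] y y-in-range)
  (∑-cong (ranks N) λ {a} _ → trans (𝟙-× (a ∈? y) (a ∉? [])) (*-identityʳ _))

-- Deleting and re-inserting a competitor

-- Deleting a competitor ranked a closes the gap with lower a; it is re-inserted either
-- tied with an existing rank a (raiseAbove a) or as a new rank a (raiseFrom a).
lower : ℕ → ℕ → ℕ
lower a x = if a <ᵇ x then pred x else x

raiseAbove : ℕ → ℕ → ℕ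
raiseAbove a x = if a <ᵇ x then suc x else x

raiseFrom : ℕ → ℕ → ℕ
raiseFrom a x = if x <ᵇ a then x else suc x

module _ {a x : ℕ} where

  lower-≤ : x ≤ a → lower a x ≡ x
  lower-≤ x≤a rewrite dec-false (a <? x) (≤⇒≯ x≤a) = refl

  lower-suc : a ≤ x → lower a (suc x) ≡ x
  lower-suc a≤x rewrite dec-true (a <? suc x) (s≤s a≤x) = refl

  raiseAbove-≤ : x ≤ a → raiseAbove a x ≡ x
  raiseAbove-≤ x≤a rewrite dec-false (a <? x) (≤⇒≯ x≤a) = refl

  raiseAbove-> : a < x → raiseAbove a x ≡ suc x
  raiseAbove-> a<x rewrite dec-true (a <? x) a<x = refl

  raiseFrom-< : x < a → raiseFrom a x ≡ x
  raiseFrom-< x<a rewrite dec-true (x <? a) x<a = refl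

  raiseFrom-≥ : a ≤ x → raiseFrom a x ≡ suc x
  raiseFrom-≥ a≤x rewrite dec-false (x <? a) (≤⇒≯ a≤x) = refl

  lower-raiseAbove : lower a (raiseAbove a x) ≡ x
  lower-raiseAbove with ≤-<-connex x a
  ... | inj₁ x≤a = trans (cong (lower a) (raiseAbove-≤ x≤a)) (lower-≤ x≤a)
  ... | inj₂ a<x = trans (cong (lower a) (raiseAbove-> a<x)) (lower-suc (<⇒≤ a<x))

  lower-raiseFrom : lower a (raiseFrom a x) ≡ x
  lower-raiseFrom with <-≤-connex x a
  ... | inj₁ x<a = trans (cong (lower a) (raiseFrom-< x<a)) (lower-≤ (<⇒≤ x<a))
  ... | inj₂ a≤x = trans (cong (lower a) (raiseFrom-≥ a≤x)) (lower-suc a≤x)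

raiseAbove-lower : {a x : ℕ} → x ≢ suc a → raiseAbove a (lower a x) ≡ x
raiseAbove-lower {a} {x} x≢1+a with ≤-<-connex x a
... | inj₁ x≤a = trans (cong (raiseAbove a) (lower-≤ x≤a)) (raiseAbove-≤ x≤a)
raiseAbove-lower {a} {suc x} 1+x≢1+a | inj₂ a<1+x =
  trans (cong (raiseAbove a) (lower-suc (≤-pred a<1+x))) (raiseAbove-> (≤∧≢⇒< (≤-pred a<1+x) (1+x≢1+a ∘ cong suc ∘ sym)))

raiseFrom-lower : {a x : ℕ} → x ≢ a → raiseFrom a (lower a x) ≡ x
raiseFrom-lower {a} {x} x≢a with ≤-<-connex x a
... | inj₁ x≤a = trans (cong (raiseFrom a) (lower-≤ x≤a)) (raiseFrom-< (≤∧≢⇒< x≤a x≢a))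
raiseFrom-lower {a} {suc x} _ | inj₂ a<1+x = trans (cong (raiseFrom a) (lower-suc (≤-pred a<1+x))) (raiseFrom-≥ (≤-pred a<1+x))

countLess-map : {h : ℕ → ℕ} {w′ w : ℕ} (ys : List ℕ) →
                (∀ {z} → z ∈ ys → h z < w′ ⇔ z < w) → countLess w′ (map h ys) ≡ countLess w ys
countLess-map {h} {w′} {w} ys same = begin
  countLess w′ (map h ys)       ≡⟨ countLess-∑ w′ (map h ys) ⟩
  ∑[ x ∈ map h ys ] 𝟙 (x <? w′) ≡⟨ ∑-map h ys ⟩
  ∑[ z ∈ ys ] 𝟙 (h z <? w′)     ≡⟨ ∑-cong ys (λ {z} z∈ → 𝟙-⇔ (same z∈) (h z <? w′) (z <? w)) ⟩
  ∑[ z ∈ ys ] 𝟙 (z <? w)        ≡⟨ sym (countLess-∑ w ys) ⟩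
  countLess w ys                ∎
  where open ≡-Reasoning

+𝟙-no : {x : ℕ} (P? : Dec P) → ¬ P → x + 𝟙 P? ≡ x
+𝟙-no {x = x} P? ¬p = trans (cong (x +_) (𝟙-no P? ¬p)) (+-identityʳ x)

+𝟙-yes : {x : ℕ} (P? : Dec P) → P → x + 𝟙 P? ≡ suc x
+𝟙-yes {x = x} P? p = trans (cong (x +_) (𝟙-yes P? p)) (+-comm x 1)

-- A raise re-inserts the rank a: it moves x up by one exactly when its image lies above a.
record IsRaise (a : ℕ) (f : ℕ → ℕ) : Set where
  field
    strictMono : ∀ {z x} → z < x → f z < f x
    shift      : ∀ x → f x ≡ x + 𝟙 (a <? f x)

shift⇒≤suc : {a : ℕ} {f : ℕ → ℕ} → (∀ x → f x ≡ x + 𝟙 (a <? f x)) → ∀ x → f x ≤ suc x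
shift⇒≤suc {a} {f} shift x = ≤-trans (≤-reflexive (shift x)) (subst (x + 𝟙 (a <? f x) ≤_) (+-comm x 1) (+-monoʳ-≤ x (𝟙≤1 (a <? f x))))

raiseAbove-isRaise : (a : ℕ) → IsRaise a (raiseAbove a)
raiseAbove-isRaise a = record { strictMono = strictMono ; shift = shift }
  where
  shift : ∀ x → raiseAbove a x ≡ x + 𝟙 (a <? raiseAbove a x)
  shift x with ≤-<-connex x a
  ... | inj₁ x≤a rewrite raiseAbove-≤ x≤a = sym (+𝟙-no (a <? x) (≤⇒≯ x≤a))
  ... | inj₂ a<x rewrite raiseAbove-> a<x = sym (+𝟙-yes (a <? suc x) (m<n⇒m<1+n a<x))
  strictMono : ∀ {z x} → z < x → raiseAbove a z < raiseAbove a x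
  strictMono {z} {x} z<x with ≤-<-connex x a
  ... | inj₁ x≤a rewrite raiseAbove-≤ x≤a | raiseAbove-≤ (≤-trans (<⇒≤ z<x) x≤a) = z<x
  ... | inj₂ a<x rewrite raiseAbove-> a<x = s≤s (≤-trans (shift⇒≤suc shift z) z<x)

raiseFrom-isRaise : (a : ℕ) → IsRaise a (raiseFrom a)
raiseFrom-isRaise a = record { strictMono = strictMono ; shift = shift }
  where
  shift : ∀ x → raiseFrom a x ≡ x + 𝟙 (a <? raiseFrom a x)
  shift x with <-≤-connex x a
  ... | inj₁ x<a rewrite raiseFrom-< x<a = sym (+𝟙-no (a <? x) (<-asym x<a))
  ... | inj₂ a≤x rewrite raiseFrom-≥ a≤x = sym (+𝟙-yes (a <? suc x) (s≤s a≤x))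
  strictMono : ∀ {z x} → z < x → raiseFrom a z < raiseFrom a x
  strictMono {z} {x} z<x with <-≤-connex x a
  ... | inj₁ x<a rewrite raiseFrom-< x<a | raiseFrom-< (<-trans z<x x<a) = z<x
  ... | inj₂ a≤x rewrite raiseFrom-≥ a≤x = s≤s (≤-trans (shift⇒≤suc shift z) z<x)

module _ {a : ℕ} {f : ℕ → ℕ} (R : IsRaise a f) where
  open IsRaise R

  raise-<⇔ : {z x : ℕ} → f z < f x ⇔ z < x
  raise-<⇔ {z} {x} = mk⇔ to strictMono
    where
    to : f z < f x → z < x
    to fz<fx with <-cmp z x
    ... | tri< z<x _ _ = z<x
    ... | tri≈ _ refl _ = contradiction fz<fx (<-irrefl refl)
    ... | tri> _ _ x<z = contradiction fz<fx (<-asym (strictMono x<z))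

  raise-injective : Injective _≡_ _≡_ f
  raise-injective {z} {x} fz≡fx with <-cmp z x
  ... | tri< z<x _ _ = contradiction fz≡fx (<⇒≢ (strictMono z<x))
  ... | tri≈ _ z≡x _ = z≡x
  ... | tri> _ _ x<z = contradiction (sym fz≡fx) (<⇒≢ (strictMono x<z))

  countLess-raise : {x : ℕ} (ys : List ℕ) → countLess (f x) (map f ys) ≡ countLess x ys
  countLess-raise ys = countLess-map ys (λ _ → raise-<⇔)

  IsTuple-raise : {y : List ℕ} → IsTuple N m y → IsTuple (suc N) m (map f y)
  IsTuple-raise {N = N} {y = y} (len , in-range) = trans (length-map f y) len , map⁺ (All.map bounds in-range)
    where
    bounds : ∀ {z} → InRange N z → InRange (suc N) (f z)
    bounds {z} (0<z , z≤N) = <-≤-trans 0<z (subst (z ≤_) (sym (shift z)) (m≤m+n z _)) ,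
                             ≤-trans (shift⇒≤suc shift z) (s≤s z≤N)

  IsFubini-raise : (y : List ℕ) → IsFubini (a ∷ map f y) ⇔ (a ≡ suc (countLess a (map f y)) × IsFubini y)
  IsFubini-raise y = mk⇔
    (λ { (a≡ ∷ rest) → trans a≡ (cong suc head) , All.map (Equivalence.to pointwise) (map⁻ rest) })
    (λ (a≡ , F) → trans a≡ (cong suc (sym head)) ∷ map⁺ (All.map (Equivalence.from pointwise) F))
    where
    head : 𝟙 (a <? a) + countLess a (map f y) ≡ countLess a (map f y)
    head = cong (_+ countLess a (map f y)) (𝟙-no (a <? a) (<-irrefl refl))
    pointwise : ∀ {x} → f x ≡ suc (𝟙 (a <? f x) + countLess (f x) (map f y)) ⇔ x ≡ suc (countLess x y)
    pointwise {x} = mk⇔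
      (λ e → +-cancelʳ-≡ jump x (suc below) (trans (sym (shift x)) (trans e (cong suc (trans (cong (jump +_) (countLess-raise y)) (+-comm jump below))))))
      (λ e → trans (shift x) (trans (cong (_+ jump) e) (cong suc (trans (+-comm below jump) (cong (jump +_) (sym (countLess-raise y)))))))
      where
      jump below : ℕ
      jump  = 𝟙 (a <? f x)
      below = countLess x y

map-inverse : {h h⁻¹ : ℕ → ℕ} {xs : List ℕ} → (∀ {x} → x ∈ xs → h⁻¹ (h x) ≡ x) → map h⁻¹ (map h xs) ≡ xs
map-inverse {xs = xs} inverse = trans (sym (map-∘ xs)) (map-id-local (tabulate inverse))

raiseFrom-<⇔ : {a z : ℕ} → raiseFrom a z < a ⇔ z < a
raiseFrom-<⇔ {a} {z} with <-≤-connex z a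
... | inj₁ z<a rewrite raiseFrom-< z<a = mk⇔ (λ z<a → z<a) (λ z<a → z<a)
... | inj₂ a≤z rewrite raiseFrom-≥ a≤z = mk⇔ (λ 1+z<a → contradiction (<-trans (n<1+n z) 1+z<a) (≤⇒≯ a≤z))
                                              (λ z<a → contradiction z<a (≤⇒≯ a≤z))

countLess-raiseFrom : {a : ℕ} (y : List ℕ) → countLess a (map (raiseFrom a) y) ≡ countLess a y
countLess-raiseFrom y = countLess-map y (λ _ → raiseFrom-<⇔)

∉-raiseFrom : {a : ℕ} (y : List ℕ) → a ∉ map (raiseFrom a) y
∉-raiseFrom {a} y a∈ with z , _ , a≡ ← ∈-map⁻ (raiseFrom a) a∈ with <-≤-connex z a
... | inj₁ z<a = <-irrefl (sym (trans a≡ (raiseFrom-< z<a))) z<a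
... | inj₂ a≤z = <-irrefl refl (subst (_≤ z) (trans a≡ (raiseFrom-≥ a≤z)) a≤z)

IsFubini-insertTie : {a : ℕ} {y : List ℕ} → IsFubini y → a ∈ y → IsFubini (a ∷ map (raiseAbove a) y)
IsFubini-insertTie {a} {y} F a∈y = Equivalence.from (IsFubini-raise (raiseAbove-isRaise a) y)
  (trans (lookup F a∈y) (cong suc (sym countLess-a)) , F)
  where
  countLess-a : countLess a (map (raiseAbove a) y) ≡ countLess a y
  countLess-a = trans (cong (λ b → countLess b (map (raiseAbove a) y)) (sym (raiseAbove-≤ ≤-refl)))
                      (countLess-raise (raiseAbove-isRaise a) y)

IsFubini-insertNew : {a : ℕ} {y : List ℕ} → IsFubini y → a ≡ suc (countLess a y) → IsFubini (a ∷ map (raiseFrom a) y)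
IsFubini-insertNew {a} {y} F a≡ = Equivalence.from (IsFubini-raise (raiseFrom-isRaise a) y)
  (trans a≡ (cong suc (sym (countLess-raiseFrom y))) , F)

reinsert : {a : ℕ} {β : List ℕ} → IsFubini (a ∷ β) →
           (a ∈ β × map (raiseAbove a) (map (lower a) β) ≡ β) ⊎ (a ∉ β × map (raiseFrom a) (map (lower a) β) ≡ β)
reinsert {a} {β} F with a ∈? β
... | yes a∈β = inj₁ (a∈β , map-inverse (λ x∈β → raiseAbove-lower {a} (λ { refl → tie-skips-next F tied (there x∈β) })))
  where
  tied : 1 < multiplicity a (a ∷ β)
  tied = subst (1 <_) (sym (multiplicity-≡ {a} β)) (s≤s (∈⇒0<multiplicity a∈β))
... | no  a∉β = inj₂ (a∉β , map-inverse (λ x∈β → raiseFrom-lower {a} (λ { refl → a∉β x∈β })))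

IsFubini-delete : {a : ℕ} {β : List ℕ} → IsFubini (a ∷ β) → IsFubini (map (lower a) β)
IsFubini-delete {a} F with reinsert F
... | inj₁ (_ , raised) = proj₂ (Equivalence.to (IsFubini-raise (raiseAbove-isRaise a) _) (subst (IsFubini ∘ (a ∷_)) (sym raised) F))
... | inj₂ (_ , raised) = proj₂ (Equivalence.to (IsFubini-raise (raiseFrom-isRaise a) _) (subst (IsFubini ∘ (a ∷_)) (sym raised) F))

deletion-fibre : {a : ℕ} {β y : List ℕ} → IsFubini y →
                 (IsFubini (a ∷ β) × map (lower a) β ≡ y) ⇔
                 ((a ∈ y × map (raiseAbove a) y ≡ β) ⊎ (a ≡ suc (countLess a y) × map (raiseFrom a) y ≡ β))
deletion-fibre {a} {β} {y} Fy = mk⇔ to from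
  where
  to : IsFubini (a ∷ β) × map (lower a) β ≡ y →
       (a ∈ y × map (raiseAbove a) y ≡ β) ⊎ (a ≡ suc (countLess a y) × map (raiseFrom a) y ≡ β)
  to (F , refl) with reinsert F
  ... | inj₁ (a∈β , raised) = inj₁ (subst (_∈ map (lower a) β) (lower-≤ ≤-refl) (∈-map⁺ (lower a) a∈β) , raised)
  ... | inj₂ (_   , raised) = inj₂ (trans a≡ (cong suc (countLess-raiseFrom (map (lower a) β))) , raised)
    where
    a≡ : a ≡ suc (countLess a (map (raiseFrom a) (map (lower a) β)))
    a≡ = proj₁ (Equivalence.to (IsFubini-raise (raiseFrom-isRaise a) _) (subst (IsFubini ∘ (a ∷_)) (sym raised) F))
  from : (a ∈ y × map (raiseAbove a) y ≡ β) ⊎ (a ≡ suc (countLess a y) × map (raiseFrom a) y ≡ β) →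
         IsFubini (a ∷ β) × map (lower a) β ≡ y
  from (inj₁ (a∈y , refl)) = IsFubini-insertTie Fy a∈y , map-inverse (λ _ → lower-raiseAbove {a})
  from (inj₂ (a≡  , refl)) = IsFubini-insertNew Fy a≡ , map-inverse (λ _ → lower-raiseFrom {a})

#distinct-insertTie : {a : ℕ} {y : List ℕ} → a ∈ y → #distinct (a ∷ map (raiseAbove a) y) ≡ #distinct y
#distinct-insertTie {a} {y} a∈y = begin
  suc (#new (a ∷ []) (map (raiseAbove a) y))                   ≡⟨ cong (λ b → suc (#new (b ∷ []) (map (raiseAbove a) y))) (sym (raiseAbove-≤ ≤-refl)) ⟩
  suc (#new (map (raiseAbove a) (a ∷ [])) (map (raiseAbove a) y)) ≡⟨ cong suc (#new-map (raise-injective (raiseAbove-isRaise a)) (a ∷ []) y) ⟩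
  suc (#new (a ∷ []) y)                                        ≡⟨ #new-∷-∈ [] y a∈y (λ ()) ⟩
  #distinct y                                                  ∎
  where open ≡-Reasoning

#distinct-insertNew : {a : ℕ} (y : List ℕ) → #distinct (a ∷ map (raiseFrom a) y) ≡ suc (#distinct y)
#distinct-insertNew {a} y =
  cong suc (trans (#new-∷-∉ [] (map (raiseFrom a) y) (∉-raiseFrom y)) (#new-map (raise-injective (raiseFrom-isRaise a)) [] y))

countLess-suc-∉ : {a : ℕ} (ys : List ℕ) → a ∉ ys → countLess (suc a) ys ≡ countLess a ys
countLess-suc-∉ {a} ys a∉ys = begin
  countLess (suc a) ys         ≡⟨ countLess-∑ (suc a) ys ⟩
  ∑[ x ∈ ys ] 𝟙 (x <? suc a)   ≡⟨ ∑-cong ys (λ {x} x∈ys → 𝟙-⇔ (below x∈ys) (x <? suc a) (x <? a)) ⟩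
  ∑[ x ∈ ys ] 𝟙 (x <? a)       ≡⟨ sym (countLess-∑ a ys) ⟩
  countLess a ys               ∎
  where
  open ≡-Reasoning
  below : ∀ {x} → x ∈ ys → x < suc a ⇔ x < a
  below x∈ys = mk⇔ (λ x<1+a → ≤∧≢⇒< (≤-pred x<1+a) (λ { refl → a∉ys x∈ys })) m<n⇒m<1+n

countLess-above : {w : ℕ} (ys : List ℕ) → All (_< w) ys → countLess w ys ≡ length ys
countLess-above {w} ys below = begin
  countLess w ys          ≡⟨ countLess-∑ w ys ⟩
  ∑[ x ∈ ys ] 𝟙 (x <? w)  ≡⟨ ∑-cong ys (λ {x} x∈ys → 𝟙-yes (x <? w) (lookup below x∈ys)) ⟩
  ∑[ x ∈ ys ] 1           ≡⟨ ∑-one ys ⟩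
  length ys               ∎
  where open ≡-Reasoning

module _ {n : ℕ} {y : List ℕ} (F : IsFubini y) (y-tuple : IsTuple n n y) where

  countLess-beyond : countLess (suc n) y ≡ n
  countLess-beyond = trans (countLess-above y (All.map (λ (_ , v≤n) → s≤s v≤n) (proj₂ y-tuple))) (proj₁ y-tuple)

  -- A missing rank a ≤ n is covered by the tie-run of the next rank above it, if any.
  missing⇒≤countLess : {a : ℕ} → a ≤ n → a ∉ y → a ≤ countLess a y
  missing⇒≤countLess {a} a≤n = go (n ∸ a) a (m+[n∸m]≡n a≤n)
    where
    go : (t a : ℕ) → a + t ≡ n → a ∉ y → a ≤ countLess a y
    go zero    a a+0≡n a∉y = ≤-reflexive (begin
      a                    ≡⟨ trans (sym (+-identityʳ a)) a+0≡n ⟩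
      n                    ≡⟨ sym countLess-beyond ⟩
      countLess (suc n) y  ≡⟨ cong (λ m → countLess (suc m) y) (trans (sym a+0≡n) (+-identityʳ a)) ⟩
      countLess (suc a) y  ≡⟨ countLess-suc-∉ y a∉y ⟩
      countLess a y        ∎)
      where open ≡-Reasoning
    go (suc t) a a+1+t≡n a∉y with suc a ∈? y
    ... | yes 1+a∈y = ≤-reflexive (trans (suc-injective (lookup F 1+a∈y)) (countLess-suc-∉ y a∉y))
    ... | no  1+a∉y = ≤-trans (n≤1+n a) (subst (suc a ≤_) (countLess-suc-∉ y a∉y)
                                                 (go t (suc a) (trans (sym (+-suc a t)) a+1+t≡n) 1+a∉y))

  newRank⇔ : {a : ℕ} → a ≤ suc n → a ≡ suc (countLess a y) ⇔ (a ∈ y ⊎ suc n ≡ a)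
  newRank⇔ {a} a≤1+n = mk⇔ to from
    where
    to : a ≡ suc (countLess a y) → a ∈ y ⊎ suc n ≡ a
    to a≡ with m≤n⇒m<n∨m≡n a≤1+n
    ... | inj₂ a≡1+n = inj₂ (sym a≡1+n)
    ... | inj₁ a<1+n with a ∈? y
    ...   | yes a∈y = inj₁ a∈y
    ...   | no  a∉y = contradiction (subst (_≤ countLess a y) a≡ (missing⇒≤countLess (≤-pred a<1+n) a∉y)) (<-irrefl refl)
    from : a ∈ y ⊎ suc n ≡ a → a ≡ suc (countLess a y)
    from (inj₁ a∈y)  = lookup F a∈y
    from (inj₂ refl) = cong suc (sym countLess-beyond)

  ∑-ranks-∈ : ∑[ a ∈ ranks (suc n) ] 𝟙 (a ∈? y) ≡ #distinct y
  ∑-ranks-∈ = sym (#distinct-∑ y (All.map (λ (0<v , v≤n) → 0<v , m≤n⇒m≤1+n v≤n) (proj₂ y-tuple)))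

  ∑-ranks-newRank : ∑[ a ∈ ranks (suc n) ] 𝟙 (a ≟ suc (countLess a y)) ≡ suc (#distinct y)
  ∑-ranks-newRank = begin
    ∑[ a ∈ ranks (suc n) ] 𝟙 (a ≟ suc (countLess a y))
      ≡⟨ ∑-cong (ranks (suc n)) (λ {a} a∈ → trans (𝟙-⇔ (newRank⇔ (proj₂ (∈-ranks⁻ a∈))) (a ≟ suc (countLess a y)) ((a ∈? y) ⊎-dec (suc n ≟ a)))
                                                  (𝟙-⊎ (λ (a∈y , 1+n≡a) → <-irrefl (sym 1+n≡a) (s≤s (proj₂ (lookup (proj₂ y-tuple) a∈y)))) (a ∈? y) (suc n ≟ a))) ⟩
    ∑[ a ∈ ranks (suc n) ] (𝟙 (a ∈? y) + 𝟙 (suc n ≟ a))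
      ≡⟨ ∑-distrib-+ {f = λ a → 𝟙 (a ∈? y)} {g = λ a → 𝟙 (suc n ≟ a)} (ranks (suc n)) ⟩
    ∑[ a ∈ ranks (suc n) ] 𝟙 (a ∈? y) + ∑[ a ∈ ranks (suc n) ] 𝟙 (suc n ≟ a)
      ≡⟨ cong₂ _+_ ∑-ranks-∈ (∑-ranks-δ {N = suc n} (s≤s z≤n , ≤-refl)) ⟩
    #distinct y + 1
      ≡⟨ +-comm (#distinct y) 1 ⟩
    suc (#distinct y) ∎
    where open ≡-Reasoning

  ∑-ranks-weighted : (u v : ℕ) → ∑[ a ∈ ranks (suc n) ] (𝟙 (a ∈? y) * u + 𝟙 (a ≟ suc (countLess a y)) * v) ≡ #distinct y * u + suc (#distinct y) * v
  ∑-ranks-weighted u v = begin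
    ∑[ a ∈ ranks (suc n) ] (𝟙 (a ∈? y) * u + 𝟙 (a ≟ suc (countLess a y)) * v)
      ≡⟨ ∑-distrib-+ {f = λ a → 𝟙 (a ∈? y) * u} {g = λ a → 𝟙 (a ≟ suc (countLess a y)) * v} (ranks (suc n)) ⟩
    ∑[ a ∈ ranks (suc n) ] (𝟙 (a ∈? y) * u) + ∑[ a ∈ ranks (suc n) ] (𝟙 (a ≟ suc (countLess a y)) * v)
      ≡⟨ cong₂ _+_ (∑-*ʳ {f = λ a → 𝟙 (a ∈? y)} u (ranks (suc n))) (∑-*ʳ {f = λ a → 𝟙 (a ≟ suc (countLess a y))} v (ranks (suc n))) ⟩
    ∑[ a ∈ ranks (suc n) ] 𝟙 (a ∈? y) * u + ∑[ a ∈ ranks (suc n) ] 𝟙 (a ≟ suc (countLess a y)) * v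
      ≡⟨ cong₂ (λ d d′ → d * u + d′ * v) ∑-ranks-∈ ∑-ranks-newRank ⟩
    #distinct y * u + suc (#distinct y) * v ∎
    where open ≡-Reasoning

-- Counting

FubiniSum : ℕ → (ℕ → ℕ) → ℕ
FubiniSum n ψ = ∑[ α ∈ tuples n n ] (𝟙 (isFubini? α) * ψ (#distinct α))

deletion? : (a : ℕ) (β y : List ℕ) → Dec (IsFubini (a ∷ β) × map (lower a) β ≡ y)
deletion? a β y = isFubini? (a ∷ β) ×-dec (map (lower a) β ≟ₗ y)

∑-deletions : {a : ℕ} {β : List ℕ} → IsTuple (suc n) n β → (w : ℕ) →
              𝟙 (isFubini? (a ∷ β)) * w ≡ ∑[ y ∈ tuples n n ] (𝟙 (isFubini? y) * (𝟙 (deletion? a β y) * w))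
∑-deletions {n} {a} {β} (len , _) w = by-cases (isFubini? (a ∷ β))
  where
  y₀ : List ℕ
  y₀ = map (lower a) β
  by-cases : (F? : Dec (IsFubini (a ∷ β))) →
             𝟙 F? * w ≡ ∑[ y ∈ tuples n n ] (𝟙 (isFubini? y) * (𝟙 (F? ×-dec (y₀ ≟ₗ y)) * w))
  by-cases (no _)  = sym (trans (∑-cong (tuples n n) (λ {y} _ → *-zeroʳ (𝟙 (isFubini? y)))) (∑-zero (tuples n n)))
  by-cases (yes F) = sym (begin
    ∑[ y ∈ tuples n n ] (𝟙 (isFubini? y) * (𝟙 (y₀ ≟ₗ y) * w)) ≡⟨ ∑-cong (tuples n n) (λ {y} _ → only-y₀ (y₀ ≟ₗ y)) ⟩
    ∑[ y ∈ tuples n n ] (𝟙 (y₀ ≟ₗ y) * w)                     ≡⟨ ∑-δ {c = y₀} {f = λ _ → w} _≟ₗ_ (tuples n n) (∑-tuples-δ y₀-tuple) ⟩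
    w                                                        ≡⟨ sym (*-identityˡ w) ⟩
    1 * w                                                    ∎)
    where
    open ≡-Reasoning
    Fy₀ : IsFubini y₀
    Fy₀ = IsFubini-delete F
    length-y₀ : length y₀ ≡ n
    length-y₀ = trans (length-map (lower a) β) len
    y₀-tuple : IsTuple n n y₀
    y₀-tuple = length-y₀ , subst (λ m → All (InRange m) y₀) length-y₀ (IsFubini⇒InRange Fy₀)
    only-y₀ : {y : List ℕ} (y₀≟y : Dec (y₀ ≡ y)) → 𝟙 (isFubini? y) * (𝟙 y₀≟y * w) ≡ 𝟙 y₀≟y * w
    only-y₀ (yes refl) = trans (cong (_* (1 * w)) (𝟙-yes (isFubini? y₀) Fy₀)) (*-identityˡ (1 * w))
    only-y₀ {y} (no _) = *-zeroʳ (𝟙 (isFubini? y))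

𝟙-deletion : {a : ℕ} {β y : List ℕ} → IsFubini y →
             𝟙 (deletion? a β y) ≡ 𝟙 (a ∈? y) * 𝟙 (map (raiseAbove a) y ≟ₗ β)
                                  + 𝟙 (a ≟ suc (countLess a y)) * 𝟙 (map (raiseFrom a) y ≟ₗ β)
𝟙-deletion {a} {β} {y} Fy = begin
  𝟙 (deletion? a β y)
    ≡⟨ 𝟙-⇔ (deletion-fibre Fy) (deletion? a β y) (tie ⊎-dec new) ⟩
  𝟙 (tie ⊎-dec new)
    ≡⟨ 𝟙-⊎ tie-and-new-disjoint tie new ⟩
  𝟙 tie + 𝟙 new
    ≡⟨ cong₂ _+_ (𝟙-× (a ∈? y) (tied ≟ₗ β)) (𝟙-× (a ≟ suc (countLess a y)) (fresh ≟ₗ β)) ⟩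
  𝟙 (a ∈? y) * 𝟙 (tied ≟ₗ β) + 𝟙 (a ≟ suc (countLess a y)) * 𝟙 (fresh ≟ₗ β) ∎
  where
  open ≡-Reasoning
  tied fresh : List ℕ
  tied  = map (raiseAbove a) y
  fresh = map (raiseFrom a) y
  tie : Dec (a ∈ y × tied ≡ β)
  tie = (a ∈? y) ×-dec (tied ≟ₗ β)
  new : Dec (a ≡ suc (countLess a y) × fresh ≡ β)
  new = (a ≟ suc (countLess a y)) ×-dec (fresh ≟ₗ β)
  tie-and-new-disjoint : ¬ ((a ∈ y × tied ≡ β) × (a ≡ suc (countLess a y) × fresh ≡ β))
  tie-and-new-disjoint ((a∈y , tied≡β) , (_ , fresh≡β)) =
    ∉-raiseFrom y (subst (a ∈_) (trans tied≡β (sym fresh≡β)) (subst (_∈ tied) (raiseAbove-≤ ≤-refl) (∈-map⁺ (raiseAbove a) a∈y)))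

∑-insertions : {a : ℕ} {y : List ℕ} → IsFubini y → IsTuple n n y → (ψ : ℕ → ℕ) →
               ∑[ β ∈ tuples (suc n) n ] (𝟙 (deletion? a β y) * ψ (#distinct (a ∷ β)))
               ≡ 𝟙 (a ∈? y) * ψ (#distinct y) + 𝟙 (a ≟ suc (countLess a y)) * ψ (suc (#distinct y))
∑-insertions {n} {a} {y} Fy y-tuple ψ = begin
  ∑[ β ∈ tuples (suc n) n ] (𝟙 (deletion? a β y) * value β)
    ≡⟨ ∑-cong (tuples (suc n) n) (λ {β} _ → trans (cong (_* value β) (𝟙-deletion Fy)) (regroup (𝟙 tie?) _ (𝟙 new?) _ (value β))) ⟩
  ∑[ β ∈ tuples (suc n) n ] (𝟙 tie? * (𝟙 (tied ≟ₗ β) * value β) + 𝟙 new? * (𝟙 (fresh ≟ₗ β) * value β))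
    ≡⟨ ∑-distrib-+ (tuples (suc n) n) ⟩
  ∑[ β ∈ tuples (suc n) n ] (𝟙 tie? * (𝟙 (tied ≟ₗ β) * value β)) + ∑[ β ∈ tuples (suc n) n ] (𝟙 new? * (𝟙 (fresh ≟ₗ β) * value β))
    ≡⟨ cong₂ _+_ (∑-*ˡ (𝟙 tie?) (tuples (suc n) n)) (∑-*ˡ (𝟙 new?) (tuples (suc n) n)) ⟩
  𝟙 tie? * ∑[ β ∈ tuples (suc n) n ] (𝟙 (tied ≟ₗ β) * value β) + 𝟙 new? * ∑[ β ∈ tuples (suc n) n ] (𝟙 (fresh ≟ₗ β) * value β)
    ≡⟨ cong₂ (λ u v → 𝟙 tie? * u + 𝟙 new? * v)
             (∑-δ {c = tied}  {f = value} _≟ₗ_ (tuples (suc n) n) (∑-tuples-δ (IsTuple-raise (raiseAbove-isRaise a) y-tuple)))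
             (∑-δ {c = fresh} {f = value} _≟ₗ_ (tuples (suc n) n) (∑-tuples-δ (IsTuple-raise (raiseFrom-isRaise a) y-tuple))) ⟩
  𝟙 tie? * value tied + 𝟙 new? * value fresh
    ≡⟨ cong₂ _+_ (𝟙-guard tie? (cong ψ ∘ #distinct-insertTie)) (cong (λ d → 𝟙 new? * ψ d) (#distinct-insertNew y)) ⟩
  𝟙 tie? * ψ (#distinct y) + 𝟙 new? * ψ (suc (#distinct y)) ∎
  where
  open ≡-Reasoning
  value : List ℕ → ℕ
  value β = ψ (#distinct (a ∷ β))
  tied fresh : List ℕ
  tied  = map (raiseAbove a) y
  fresh = map (raiseFrom a) y
  tie? : Dec (a ∈ y)
  tie? = a ∈? y
  new? : Dec (a ≡ suc (countLess a y))
  new? = a ≟ suc (countLess a y)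
  regroup : ∀ p q r s u → (p * q + r * s) * u ≡ p * (q * u) + r * (s * u)
  regroup = solve 5 (λ p q r s u → (p :* q :+ r :* s) :* u := p :* (q :* u) :+ r :* (s :* u)) refl

FubiniSum-suc : (n : ℕ) (ψ : ℕ → ℕ) → FubiniSum (suc n) ψ ≡ FubiniSum n (λ d → d * ψ d + suc d * ψ (suc d))
FubiniSum-suc n ψ = begin
  FubiniSum (suc n) ψ
    ≡⟨ ∑-tuples-suc (suc n) n (λ α → 𝟙 (isFubini? α) * ψ (#distinct α)) ⟩
  ∑[ a ∈ ranks (suc n) ] ∑[ β ∈ tuples (suc n) n ] (𝟙 (isFubini? (a ∷ β)) * ψ (#distinct (a ∷ β)))
    ≡⟨ ∑-cong (ranks (suc n)) (λ {a} _ → ∑-cong (tuples (suc n) n) (λ {β} β∈ → ∑-deletions {n = n} {a} (∈-tuples⁻ β∈) (ψ (#distinct (a ∷ β))))) ⟩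
  ∑[ a ∈ ranks (suc n) ] ∑[ β ∈ tuples (suc n) n ] ∑[ y ∈ tuples n n ] (𝟙 (isFubini? y) * (𝟙 (deletion? a β y) * ψ (#distinct (a ∷ β))))
    ≡⟨ ∑-cong (ranks (suc n)) (λ _ → ∑-comm (tuples (suc n) n) (tuples n n) _) ⟩
  ∑[ a ∈ ranks (suc n) ] ∑[ y ∈ tuples n n ] ∑[ β ∈ tuples (suc n) n ] (𝟙 (isFubini? y) * (𝟙 (deletion? a β y) * ψ (#distinct (a ∷ β))))
    ≡⟨ ∑-cong (ranks (suc n)) (λ _ → ∑-cong (tuples n n) (λ {y} y∈ →
         trans (∑-*ˡ (𝟙 (isFubini? y)) (tuples (suc n) n)) (𝟙-guard (isFubini? y) (λ Fy → ∑-insertions {n = n} Fy (∈-tuples⁻ y∈) ψ)))) ⟩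
  ∑[ a ∈ ranks (suc n) ] ∑[ y ∈ tuples n n ] (𝟙 (isFubini? y) * extensions a y)
    ≡⟨ ∑-comm (ranks (suc n)) (tuples n n) _ ⟩
  ∑[ y ∈ tuples n n ] ∑[ a ∈ ranks (suc n) ] (𝟙 (isFubini? y) * extensions a y)
    ≡⟨ ∑-cong (tuples n n) (λ {y} y∈ →
         trans (∑-*ˡ (𝟙 (isFubini? y)) (ranks (suc n))) (𝟙-guard (isFubini? y) (λ Fy → ∑-ranks-weighted {n = n} Fy (∈-tuples⁻ y∈) _ _))) ⟩
  FubiniSum n (λ d → d * ψ d + suc d * ψ (suc d)) ∎
  where
  open ≡-Reasoning
  extensions : ℕ → List ℕ → ℕ
  extensions a y = 𝟙 (a ∈? y) * ψ (#distinct y) + 𝟙 (a ≟ suc (countLess a y)) * ψ (suc (#distinct y))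

FubiniSum-cong : (n : ℕ) {ψ φ : ℕ → ℕ} → (∀ d → ψ d ≡ φ d) → FubiniSum n ψ ≡ FubiniSum n φ
FubiniSum-cong n ψ≡φ = ∑-cong (tuples n n) (λ {α} _ → cong (𝟙 (isFubini? α) *_) (ψ≡φ (#distinct α)))

FubiniSum-zero : (n : ℕ) → FubiniSum n (λ _ → 0) ≡ 0
FubiniSum-zero n = trans (∑-cong (tuples n n) (λ {α} _ → *-zeroʳ (𝟙 (isFubini? α)))) (∑-zero (tuples n n))

FubiniSum-*-+ : (n c : ℕ) (ψ φ : ℕ → ℕ) → FubiniSum n (λ d → c * ψ d + c * φ d) ≡ c * (FubiniSum n ψ + FubiniSum n φ)
FubiniSum-*-+ n c ψ φ = begin
  FubiniSum n (λ d → c * ψ d + c * φ d)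
    ≡⟨ ∑-cong (tuples n n) (λ {α} _ → distribute (𝟙 (isFubini? α)) (ψ (#distinct α)) (φ (#distinct α))) ⟩
  ∑[ α ∈ tuples n n ] (c * (𝟙 (isFubini? α) * ψ (#distinct α) + 𝟙 (isFubini? α) * φ (#distinct α)))
    ≡⟨ ∑-*ˡ c (tuples n n) ⟩
  c * ∑[ α ∈ tuples n n ] (𝟙 (isFubini? α) * ψ (#distinct α) + 𝟙 (isFubini? α) * φ (#distinct α))
    ≡⟨ cong (c *_) (∑-distrib-+ (tuples n n)) ⟩
  c * (FubiniSum n ψ + FubiniSum n φ) ∎
  where
  open ≡-Reasoning
  distribute : ∀ i p q → i * (c * p + c * q) ≡ c * (i * p + i * q)
  distribute = solve 4 (λ c i p q → i :* (c :* p :+ c :* q) := c :* (i :* p :+ i :* q)) refl c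

fubiniCount : ℕ → ℕ → ℕ
fubiniCount n k = FubiniSum n (λ d → 𝟙 (d ≟ k))

𝟙-does-≟true : (P? : Dec P) → 𝟙 (does P? Data.Bool.≟ true) ≡ 𝟙 P?
𝟙-does-≟true (yes _) = refl
𝟙-does-≟true (no _)  = refl

fFR≡fubiniCount : (n k : ℕ) → fFR n k ≡ fubiniCount n k
fFR≡fubiniCount n k = begin
  fFR n k
    ≡⟨ length-filter (λ α → lucky α ≟ k) (fubiniRankings n) ⟩
  ∑[ α ∈ fubiniRankings n ] 𝟙 (lucky α ≟ k)
    ≡⟨ ∑-filter (λ α → isFubiniᵇ α Data.Bool.≟ true) (tuples n n) ⟩
  ∑[ α ∈ tuples n n ] (𝟙 (isFubiniᵇ α Data.Bool.≟ true) * 𝟙 (lucky α ≟ k))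
    ≡⟨ ∑-cong (tuples n n) (λ {α} _ → cong₂ _*_ (is-fubini α) refl) ⟩
  ∑[ α ∈ tuples n n ] (𝟙 (isFubini? α) * 𝟙 (lucky α ≟ k))
    ≡⟨ ∑-cong (tuples n n) (λ {α} _ → 𝟙-guard (isFubini? α) (λ F → cong (λ l → 𝟙 (l ≟ k)) (lucky≡#distinct F))) ⟩
  fubiniCount n k ∎
  where
  open ≡-Reasoning
  is-fubini : ∀ α → 𝟙 (isFubiniᵇ α Data.Bool.≟ true) ≡ 𝟙 (isFubini? α)
  is-fubini α = trans (cong (λ b → 𝟙 (b Data.Bool.≟ true)) (isFubiniᵇ-does α)) (𝟙-does-≟true (isFubini? α))

*-𝟙-≟ : (d k : ℕ) → d * 𝟙 (d ≟ k) ≡ k * 𝟙 (d ≟ k)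
*-𝟙-≟ d k = trans (*-comm d _) (trans (𝟙-guard (d ≟ k) (λ d≡k → d≡k)) (*-comm _ k))

fubiniCount-suc-zero : (n : ℕ) → fubiniCount (suc n) 0 ≡ 0
fubiniCount-suc-zero n = begin
  fubiniCount (suc n) 0                                          ≡⟨ FubiniSum-suc n (λ d → 𝟙 (d ≟ 0)) ⟩
  FubiniSum n (λ d → d * 𝟙 (d ≟ 0) + suc d * 𝟙 (suc d ≟ 0))      ≡⟨ FubiniSum-cong n (λ d → cong₂ _+_ (*-𝟙-≟ d 0) (*-zeroʳ (suc d))) ⟩
  FubiniSum n (λ _ → 0)                                          ≡⟨ FubiniSum-zero n ⟩
  0                                                              ∎
  where open ≡-Reasoning

fubiniCount-suc-suc : (n k : ℕ) → fubiniCount (suc n) (suc k) ≡ suc k * (fubiniCount n (suc k) + fubiniCount n k)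
fubiniCount-suc-suc n k = begin
  fubiniCount (suc n) (suc k)                                                  ≡⟨ FubiniSum-suc n (λ d → 𝟙 (d ≟ suc k)) ⟩
  FubiniSum n (λ d → d * 𝟙 (d ≟ suc k) + suc d * 𝟙 (suc d ≟ suc k))            ≡⟨ FubiniSum-cong n (λ d → cong₂ _+_ (*-𝟙-≟ d (suc k)) (*-𝟙-≟ (suc d) (suc k))) ⟩
  FubiniSum n (λ d → suc k * 𝟙 (d ≟ suc k) + suc k * 𝟙 (d ≟ k))                ≡⟨ FubiniSum-*-+ n (suc k) (λ d → 𝟙 (d ≟ suc k)) (λ d → 𝟙 (d ≟ k)) ⟩
  suc k * (fubiniCount n (suc k) + fubiniCount n k)                            ∎
  where open ≡-Reasoning

fubiniCount≡k!*S : (n k : ℕ) → fubiniCount n k ≡ (k !) * S n k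
fubiniCount≡k!*S zero    zero    = refl
fubiniCount≡k!*S zero    (suc k) = sym (*-zeroʳ (suc k !))
fubiniCount≡k!*S (suc n) zero    = fubiniCount-suc-zero n
fubiniCount≡k!*S (suc n) (suc k) = begin
  fubiniCount (suc n) (suc k)                                ≡⟨ fubiniCount-suc-suc n k ⟩
  suc k * (fubiniCount n (suc k) + fubiniCount n k)          ≡⟨ cong (λ s → suc k * s) (cong₂ _+_ (fubiniCount≡k!*S n (suc k)) (fubiniCount≡k!*S n k)) ⟩
  suc k * (suc k ! * S n (suc k) + k ! * S n k)              ≡⟨ regroup (suc k) (k !) (S n (suc k)) (S n k) ⟩
  suc k ! * (suc k * S n (suc k) + S n k)                    ∎
  where
  open ≡-Reasoning
  regroup : ∀ c f s t → c * ((c * f) * s + f * t) ≡ (c * f) * (c * s + t)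
  regroup = solve 4 (λ c f s t → c :* ((c :* f) :* s :+ f :* t) := (c :* f) :* (c :* s :+ t)) refl

corollary2p5 : (n k : ℕ) → fFR (suc n) k ≡ (k !) * S (suc n) k
corollary2p5 n k = trans (fFR≡fubiniCount (suc n) k) (fubiniCount≡k!*S (suc n) k)
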